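{- Let $k$ be a field of characteristic $p$, $p$ an odd prime, $d$ a positive integer not divisible by $p$, $S=k[a_0,\dots,a_d]$ a polynomial ring, $f=a_0+a_1x+\cdots+a_dx^d\in S[x]$, and for $0\le\lambda<p$ and $n\ge0$ let $b_{\lambda,n}\in S$ be the coefficient of $x^n$ in $f^\lambda$ (so $b_{\lambda,n}=0$ for $n>\lambda d$). Fix $1<J<p$ and let \[C_J=\left\{i'\in\mathbb{Z}\ \middle|\ 0<i'<\tfrac{(p-J)d}{p},\ p\nmid i'\right\},\quad R_J=\left\{(i,\lambda)\in\mathbb{Z}^2\ \middle|\ 0<\lambda<J,\ \tfrac{(p\lambda-J+1)d}{p^2}<i<\tfrac{(p(\lambda+1)-J)d}{p^2}\right\},\] and let $M$ be the matrix with rows indexed by $R_J$, columns indexed by $C_J$, and entries $M_{(i,\lambda),i'}=b_{\lambda,pi-i'}$. Then: (1) if $(i,\lambda)\in R_J$ and $i'\in C_J$ satisfy $pi-i'>\lambda d$ (so $M_{(i,\lambda),i'}=0$), then there exists $i''\in C_J$ with $i''>i'$ and $M_{(i,\lambda),i''}=b_{\lambda,\lambda d}=a_d^\lambda$; in particular no row of $M$ is zero; (2) for all $((i,\lambda),i')\in R_J\times C_J$ we have $pi-i'>(\lambda-1)d$. -}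

module Defs where

open import Level using (Level; _⊔_)
open import Algebra.Bundles using (CommutativeRing)
import Algebra.Definitions.RawMonoid as RawMonoidDefs
open import Data.Nat as ℕ using (ℕ; zero; suc)
open import Data.Integer as ℤ using (ℤ; +_; -[1+_])
import Data.Integer.Divisibility as ℤDiv
open import Data.Fin using (Fin; fromℕ)
open import Data.Fin as Fin using ()
open import Data.Vec as Vec using (Vec; []; _∷_; tabulate; zipWith; replicate)
open import Data.Vec.Properties using (≡-dec)
open import Data.List as List using (List; []; _∷_; map; concatMap; upTo; foldr; [_])
open import Data.Bool using (if_then_else_)
open import Data.Product using (Σ; _×_; ∃)
open import Relation.Nullary using (¬_)
open import Relation.Nullary.Decidable using (⌊_⌋)

module _ {c ℓ : Level} (K : CommutativeRing c ℓ) where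
  open CommutativeRing K

  IsField : Set (c ⊔ ℓ)
  IsField = (¬ (1# ≈ 0#)) × (∀ x → ¬ (x ≈ 0#) → ∃ λ y → (x * y) ≈ 1#)

  open RawMonoidDefs +-rawMonoid using () renaming (_×_ to _·ℕ_)

  HasCharacteristic : ℕ → Set ℓ
  HasCharacteristic n =
    (0 ℕ.< n) × ((n ·ℕ 1#) ≈ 0#) × (∀ m → 0 ℕ.< m → (m ·ℕ 1#) ≈ 0# → n ℕ.≤ m)

-- An element of S is represented by its coefficient function on
-- monomials; a monomial a_0^{e_0}⋯a_d^{e_d} is its exponent vector
-- e : Vec ℕ (suc d).
-- Elements of S[x] are lists of coefficients in S (entry n = coeff of x^n).

module Poly {c ℓ : Level} (K : CommutativeRing c ℓ) (d : ℕ) where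
  open CommutativeRing K

  Mon : Set
  Mon = Vec ℕ (suc d)

  S : Set c
  S = Mon → Carrier

  _≈S_ : S → S → Set ℓ
  g ≈S h = ∀ e → g e ≈ h e

  box : ∀ {n} → Vec ℕ n → List (Vec ℕ n)
  box []      = [ [] ]
  box (m ∷ e) = concatMap (λ j → map (j ∷_) (box e)) (upTo (suc m))

  sumK : List Carrier → Carrier
  sumK = foldr _+_ 0#

  0S : S
  0S _ = 0#

  _+S_ : S → S → S
  (g +S h) e = g e + h e

  _*S_ : S → S → S
  (g *S h) e = sumK (map (λ e₁ → g e₁ * h (zipWith ℕ._∸_ e e₁)) (box e))

  mono : Mon → S
  mono m e = if ⌊ ≡-dec ℕ._≟_ e m ⌋ then 1# else 0#

  1S : S
  1S = mono (replicate (suc d) 0)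

  a : Fin (suc d) → S
  a j = mono (tabulate (λ i → if ⌊ i Fin.≟ j ⌋ then 1 else 0))

  _^S_ : S → ℕ → S
  g ^S zero  = 1S
  g ^S suc n = g *S (g ^S n)

  PolyS : Set c
  PolyS = List S

  _+P_ : PolyS → PolyS → PolyS
  []      +P q       = q
  (u ∷ p) +P []      = u ∷ p
  (u ∷ p) +P (v ∷ q) = (u +S v) ∷ (p +P q)

  _*P_ : PolyS → PolyS → PolyS
  []      *P q = []
  (u ∷ p) *P q = map (u *S_) q +P (0S ∷ (p *P q))

  f : PolyS
  f = Vec.toList (tabulate a)

  _^P_ : PolyS → ℕ → PolyS
  p ^P zero  = [ 1S ]
  p ^P suc n = p *P (p ^P n)

  -- coefficient of x^n (zero beyond the length of the list)
  coeff : PolyS → ℕ → S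
  coeff []      _       = 0S
  coeff (u ∷ p) zero    = u
  coeff (u ∷ p) (suc n) = coeff p n

  b : ℕ → ℕ → S
  b λ′ n = coeff (f ^P λ′) n

  -- b_{λ,n} for an integer index n (zero for n < 0, a convention
  -- that is never exercised by the statement, cf. part (2))
  bℤ : ℕ → ℤ → S
  bℤ λ′ (+ n)     = b λ′ n
  bℤ λ′ -[1+ n ]  = 0S

  M : (p : ℕ) → ℤ → ℕ → ℤ → S
  M p i λ′ i′ = bℤ λ′ (+ p ℤ.* i ℤ.- i′)

-- The index sets C_J and R_J (denominators cleared; p > 0).

InC : (p d J : ℕ) → ℤ → Set
InC p d J i′ =
  (ℤ.0ℤ ℤ.< i′) × (+ p ℤ.* i′ ℤ.< (+ p ℤ.- + J) ℤ.* + d) × (¬ (+ p ℤDiv.∣ i′))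

InR : (p d J : ℕ) → ℤ → ℕ → Set
InR p d J i λ′ =
  (0 ℕ.< λ′) × (λ′ ℕ.< J)
  × ((+ p ℤ.* + λ′ ℤ.- + J ℤ.+ ℤ.1ℤ) ℤ.* + d ℤ.< + (p ℕ.* p) ℤ.* i)
  × (+ (p ℕ.* p) ℤ.* i ℤ.< (+ p ℤ.* (+ λ′ ℤ.+ ℤ.1ℤ) ℤ.- + J) ℤ.* + d)

{-# OPTIONS --safe #-}
module Submission where

-- Part (2): adding the lower bound on p²i from R_J to the upper bound on pi′ from C_J
-- gives p(pi − i′) > (pλ − p + 1)d > p(λ − 1)d.
-- Part (1): take i″ = pi − λd, so that M_{(i,λ),i″} = b_{λ,λd}, the leading coefficient
-- a_d^λ of f^λ.  Then i″ > i′ is exactly the hypothesis pi − i′ > λd, the upper bound on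
-- i in R_J gives pi″ < (p − J)d, and p ∤ i″ because p ∣ pi while p ∤ λd (p is prime,
-- 0 < λ < p and p ∤ d).

open import Defs
open import Level using (Level)
open import Algebra.Bundles using (CommutativeRing)
open import Data.Nat using (ℕ; _<_; _*_)
open import Data.Nat.Divisibility using (_∣_)
open import Data.Nat.Primality using (Prime)
open import Data.Integer as ℤ using (ℤ; +_)
open import Data.Fin using (fromℕ)
open import Data.Product using (_×_; ∃)
open import Relation.Nullary using (¬_)

open import Data.Nat using (zero; suc; _+_; _≤_; _⊔_; s≤s; >-nonZero)
open import Data.Nat.Properties using (≤-trans; ≤-reflexive; <-trans; m≤n+m; m≤n⇒m⊔n≡n; m≤n⇒m≤1+n; ⊔-identityʳ)
open import Data.Nat.Divisibility using (_∤_; >⇒∤)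
open import Data.Nat.Primality using (euclidsLemma)
open import Data.Integer.Properties
  using (module ≤-Reasoning; i≤i+j; +-mono-<; +-monoʳ-<; +-monoˡ-<; neg-mono-<; *-cancelˡ-<-nonNeg; pos-*)
import Data.Integer.Properties as ℤP
open import Data.Integer.Tactic.RingSolver using (solve; solve-∀)
import Data.Integer.Divisibility as ℤᵘ
open import Data.Integer.Divisibility.Signed as ℤˢ using (∣ᵤ⇒∣; ∣⇒∣ᵤ; ∣-refl; ∣m∣n⇒∣m-n; ∣m⇒∣m*n)
open import Data.Fin as Fin using (Fin)
open import Data.Vec using (tabulate; toList)
open import Data.Vec.Properties using (length-toList)
open import Data.List using ([]; _∷_; map; length)
open import Data.List.Properties using (length-map)
open import Data.Product using (_,_)
open import Data.Sum using ([_,_]′)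
open import Relation.Binary.PropositionalEquality using (_≡_; cong; cong₂; subst)
import Relation.Binary.PropositionalEquality as ≡
import Relation.Binary.Reasoning.Setoid as SetoidReasoning

j-[j-k]≡k : ∀ j k → j ℤ.- (j ℤ.- k) ≡ k
j-[j-k]≡k = solve-∀

i<j-k⇒k<j-i : ∀ {i j k} → i ℤ.< j ℤ.- k → k ℤ.< j ℤ.- i
i<j-k⇒k<j-i {i} {j} {k} i<j-k = begin-strict
  k                   ≡⟨ ≡.sym (j-[j-k]≡k j k) ⟩
  j ℤ.- (j ℤ.- k)     <⟨ +-monoʳ-< j (neg-mono-< i<j-k) ⟩
  j ℤ.- i             ∎
  where open ≤-Reasoning

row-column-gap : ∀ p .{{_ : ℤ.NonNegative p}} d .{{_ : ℤ.NonNegative d}} λ′ J i i′ →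
                 (p ℤ.* λ′ ℤ.- J ℤ.+ ℤ.1ℤ) ℤ.* d ℤ.< p ℤ.* p ℤ.* i →
                 p ℤ.* i′ ℤ.< (p ℤ.- J) ℤ.* d →
                 (λ′ ℤ.- ℤ.1ℤ) ℤ.* d ℤ.< p ℤ.* i ℤ.- i′
row-column-gap p d λ′ J i i′ row-lower column-upper = *-cancelˡ-<-nonNeg p (begin-strict
  p ℤ.* ((λ′ ℤ.- ℤ.1ℤ) ℤ.* d)                            ≤⟨ i≤i+j _ d ⟩
  p ℤ.* ((λ′ ℤ.- ℤ.1ℤ) ℤ.* d) ℤ.+ d                      ≡⟨ solve (p ∷ d ∷ λ′ ∷ J ∷ []) ⟩
  (p ℤ.* λ′ ℤ.- J ℤ.+ ℤ.1ℤ) ℤ.* d ℤ.- (p ℤ.- J) ℤ.* d    <⟨ +-mono-< row-lower (neg-mono-< column-upper) ⟩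
  p ℤ.* p ℤ.* i ℤ.- p ℤ.* i′                             ≡⟨ solve (p ∷ i ∷ i′ ∷ []) ⟩
  p ℤ.* (p ℤ.* i ℤ.- i′)                                 ∎)
  where open ≤-Reasoning

shifted-column-upper : ∀ p d λ′ J i → p ℤ.* p ℤ.* i ℤ.< (p ℤ.* (λ′ ℤ.+ ℤ.1ℤ) ℤ.- J) ℤ.* d →
                       p ℤ.* (p ℤ.* i ℤ.- λ′ ℤ.* d) ℤ.< (p ℤ.- J) ℤ.* d
shifted-column-upper p d λ′ J i row-upper = begin-strict
  p ℤ.* (p ℤ.* i ℤ.- λ′ ℤ.* d)                              ≡⟨ solve (p ∷ d ∷ λ′ ∷ i ∷ []) ⟩
  p ℤ.* p ℤ.* i ℤ.- p ℤ.* (λ′ ℤ.* d)                        <⟨ +-monoˡ-< (ℤ.- (p ℤ.* (λ′ ℤ.* d))) row-upper ⟩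
  (p ℤ.* (λ′ ℤ.+ ℤ.1ℤ) ℤ.- J) ℤ.* d ℤ.- p ℤ.* (λ′ ℤ.* d)    ≡⟨ solve (p ∷ d ∷ λ′ ∷ J ∷ []) ⟩
  (p ℤ.- J) ℤ.* d                                            ∎
  where open ≤-Reasoning

∤m⇒∤q*i-m : ∀ {q} i m → ¬ (q ℤᵘ.∣ m) → ¬ (q ℤᵘ.∣ q ℤ.* i ℤ.- m)
∤m⇒∤q*i-m {q} i m q∤m q∣qi-m = q∤m (∣⇒∣ᵤ (subst (q ℤˢ.∣_) (j-[j-k]≡k (q ℤ.* i) m) q∣qi-[qi-m]))
  where
  q∣qi-[qi-m] : q ℤˢ.∣ q ℤ.* i ℤ.- (q ℤ.* i ℤ.- m)
  q∣qi-[qi-m] = ∣m∣n⇒∣m-n (∣m⇒∣m*n i ∣-refl) (∣ᵤ⇒∣ q∣qi-m)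

prime-∤-* : ∀ {p m n} → Prime p → p ∤ m → p ∤ n → p ∤ m * n
prime-∤-* {m = m} {n} p-prime p∤m p∤n p∣mn = [ p∤m , p∤n ]′ (euclidsLemma m n p-prime p∣mn)

module Coefficients {c ℓ : Level} (K : CommutativeRing c ℓ) (d : ℕ) where
  open CommutativeRing K renaming (_+_ to _+ᴷ_; _*_ to _*ᴷ_)
  open Poly K d

  sumK-zero : ∀ {A : Set} (g : A → Carrier) xs → (∀ x → g x ≈ 0#) → sumK (map g xs) ≈ 0#
  sumK-zero g []       g≈0 = refl
  sumK-zero g (x ∷ xs) g≈0 = trans (+-cong (g≈0 x) (sumK-zero g xs g≈0)) (+-identityˡ 0#)

  sumK-cong : ∀ {A : Set} {g h : A → Carrier} xs → (∀ x → g x ≈ h x) → sumK (map g xs) ≈ sumK (map h xs)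
  sumK-cong []       g≈h = refl
  sumK-cong (x ∷ xs) g≈h = +-cong (g≈h x) (sumK-cong xs g≈h)

  *S-zeroʳ : ∀ u → (u *S 0S) ≈S 0S
  *S-zeroʳ u e = sumK-zero _ (box e) (λ e₁ → zeroʳ (u e₁))

  *S-congˡ : ∀ u {g h} → g ≈S h → (u *S g) ≈S (u *S h)
  *S-congˡ u g≈h e = sumK-cong (box e) (λ e₁ → *-congˡ (g≈h _))

  coeff-+P : ∀ p q n → coeff (p +P q) n ≈S (coeff p n +S coeff q n)
  coeff-+P []      q       n       e = sym (+-identityˡ _)
  coeff-+P (u ∷ p) []      n       e = sym (+-identityʳ _)
  coeff-+P (u ∷ p) (v ∷ q) zero    e = refl
  coeff-+P (u ∷ p) (v ∷ q) (suc n) e = coeff-+P p q n e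

  coeff-map-*S : ∀ u q n → coeff (map (u *S_) q) n ≈S (u *S coeff q n)
  coeff-map-*S u []      n       e = sym (*S-zeroʳ u e)
  coeff-map-*S u (v ∷ q) zero    e = refl
  coeff-map-*S u (v ∷ q) (suc n) e = coeff-map-*S u q n e

  coeff-≥length : ∀ q {n} → length q ≤ n → coeff q n ≈S 0S
  coeff-≥length []      _         e = refl
  coeff-≥length (v ∷ q) (s≤s q≤n) e = coeff-≥length q q≤n e

  coeff-0S∷[] : ∀ n → coeff (0S ∷ []) n ≈S 0S
  coeff-0S∷[] zero    e = refl
  coeff-0S∷[] (suc n) e = refl

  coeff-∷*P : ∀ u p q n → coeff ((u ∷ p) *P q) n ≈S ((u *S coeff q n) +S coeff (0S ∷ (p *P q)) n)
  coeff-∷*P u p q n e = trans (coeff-+P (map (u *S_) q) (0S ∷ (p *P q)) n e) (+-congʳ (coeff-map-*S u q n e))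

  length-+P : ∀ p q → length (p +P q) ≡ length p ⊔ length q
  length-+P []      q       = ≡.refl
  length-+P (u ∷ p) []      = ≡.refl
  length-+P (u ∷ p) (v ∷ q) = cong suc (length-+P p q)

  length-∷*P : ∀ u p q → length ((u ∷ p) *P q) ≡ length q ⊔ suc (length (p *P q))
  length-∷*P u p q = ≡.trans (length-+P (map (u *S_) q) (0S ∷ (p *P q))) (cong (_⊔ _) (length-map (u *S_) q))

  length-*P : ∀ p q {m k} → length p ≡ suc m → length q ≡ suc k → length (p *P q) ≡ suc (m + k)
  length-*P (u ∷ []) q {zero} {k} ≡.refl ∣q∣ =
    ≡.trans (length-∷*P u [] q) (≡.trans (cong (_⊔ 1) ∣q∣) (cong suc (⊔-identityʳ k)))
  length-*P (u ∷ v ∷ p) q {suc m} {k} ≡.refl ∣q∣ =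
    ≡.trans (length-∷*P u (v ∷ p) q)
      (≡.trans (cong₂ _⊔_ ∣q∣ (cong suc (length-*P (v ∷ p) q ≡.refl ∣q∣)))
               (m≤n⇒m⊔n≡n (s≤s (m≤n⇒m≤1+n (m≤n+m k m)))))

  coeff-*P-top : ∀ p q {m k} → length p ≡ suc m → length q ≡ suc k →
                 coeff (p *P q) (m + k) ≈S (coeff p m *S coeff q k)
  coeff-*P-top (u ∷ []) q {zero} {k} ≡.refl ∣q∣ e = begin
    coeff ((u ∷ []) *P q) k e                    ≈⟨ coeff-∷*P u [] q k e ⟩
    (u *S coeff q k) e +ᴷ coeff (0S ∷ []) k e    ≈⟨ +-congˡ (coeff-0S∷[] k e) ⟩
    (u *S coeff q k) e +ᴷ 0#                     ≈⟨ +-identityʳ _ ⟩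
    (u *S coeff q k) e                           ∎
    where open SetoidReasoning setoid
  coeff-*P-top (u ∷ v ∷ p) q {suc m} {k} ≡.refl ∣q∣ e = begin
    coeff ((u ∷ v ∷ p) *P q) (suc m + k) e                           ≈⟨ coeff-∷*P u (v ∷ p) q (suc m + k) e ⟩
    (u *S coeff q (suc m + k)) e +ᴷ coeff ((v ∷ p) *P q) (m + k) e   ≈⟨ +-cong q-vanishes (coeff-*P-top (v ∷ p) q ≡.refl ∣q∣ e) ⟩
    0# +ᴷ (coeff (v ∷ p) m *S coeff q k) e                           ≈⟨ +-identityˡ _ ⟩
    (coeff (v ∷ p) m *S coeff q k) e                                 ∎
    where
    open SetoidReasoning setoid
    q-vanishes : (u *S coeff q (suc m + k)) e ≈ 0#
    q-vanishes = trans (*S-congˡ u (coeff-≥length q (≤-trans (≤-reflexive ∣q∣) (s≤s (m≤n+m k m)))) e)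
                       (*S-zeroʳ u e)

  coeff-toList-tabulate : ∀ n (g : Fin (suc n) → S) → coeff (toList (tabulate g)) n ≡ g (fromℕ n)
  coeff-toList-tabulate zero    g = ≡.refl
  coeff-toList-tabulate (suc n) g = coeff-toList-tabulate n (λ i → g (Fin.suc i))

  length-f : length f ≡ suc d
  length-f = length-toList (tabulate a)

  length-f^P : ∀ n → length (f ^P n) ≡ suc (n * d)
  length-f^P zero    = ≡.refl
  length-f^P (suc n) = length-*P f (f ^P n) length-f (length-f^P n)

  coeff-f^P-top : ∀ n → coeff (f ^P n) (n * d) ≈S (a (fromℕ d) ^S n)
  coeff-f^P-top zero    e = refl
  coeff-f^P-top (suc n) e = begin
    coeff (f *P (f ^P n)) (d + n * d) e         ≈⟨ coeff-*P-top f (f ^P n) length-f (length-f^P n) e ⟩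
    (coeff f d *S coeff (f ^P n) (n * d)) e     ≡⟨ cong (λ u → (u *S coeff (f ^P n) (n * d)) e) (coeff-toList-tabulate d a) ⟩
    (a (fromℕ d) *S coeff (f ^P n) (n * d)) e   ≈⟨ *S-congˡ (a (fromℕ d)) (coeff-f^P-top n) e ⟩
    (a (fromℕ d) *S (a (fromℕ d) ^S n)) e       ∎
    where open SetoidReasoning setoid

  M-shifted-column : ∀ p i λ′ n → M p i λ′ (+ p ℤ.* i ℤ.- + n) ≈S b λ′ n
  M-shifted-column p i λ′ n rewrite j-[j-k]≡k (+ p ℤ.* i) (+ n) = λ e → refl

InR∧InC⇒degree-gap : ∀ {p d J i λ′ i′} → InR p d J i λ′ → InC p d J i′ →
                     (+ λ′ ℤ.- ℤ.1ℤ) ℤ.* + d ℤ.< + p ℤ.* i ℤ.- i′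
InR∧InC⇒degree-gap {p} {d} {J} {i} {λ′} {i′} (_ , _ , row-lower , _) (_ , column-upper , _) =
  row-column-gap (+ p) (+ d) (+ λ′) (+ J) i i′
    (subst (_ ℤ.<_) (cong (ℤ._* i) (pos-* p p)) row-lower) column-upper

leading-column : ∀ {p d J i λ′ i′} → Prime p → p ∤ d → J < p → InR p d J i λ′ → InC p d J i′ →
                 + (λ′ * d) ℤ.< + p ℤ.* i ℤ.- i′ →
                 InC p d J (+ p ℤ.* i ℤ.- + (λ′ * d)) × i′ ℤ.< + p ℤ.* i ℤ.- + (λ′ * d)
leading-column {p} {d} {J} {i} {λ′} {i′} p-prime p∤d J<p
               (0<λ′ , λ′<J , _ , row-upper) (0<i′ , _ , _) λd<pi-i′ =
  (ℤP.<-trans 0<i′ i′<i″ , p*i″<[p-J]*d , ∤m⇒∤q*i-m {+ p} i (+ (λ′ * d)) (prime-∤-* p-prime p∤λ′ p∤d))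
  , i′<i″
  where
  i′<i″ : i′ ℤ.< + p ℤ.* i ℤ.- + (λ′ * d)
  i′<i″ = i<j-k⇒k<j-i {j = + p ℤ.* i} λd<pi-i′
  p∤λ′ : p ∤ λ′
  p∤λ′ = >⇒∤ {{>-nonZero 0<λ′}} (<-trans λ′<J J<p)
  p*i″<[p-J]*d : + p ℤ.* (+ p ℤ.* i ℤ.- + (λ′ * d)) ℤ.< (+ p ℤ.- + J) ℤ.* + d
  p*i″<[p-J]*d =
    subst (ℤ._< _) (cong (λ n → + p ℤ.* (+ p ℤ.* i ℤ.- n)) (≡.sym (pos-* λ′ d)))
      (shifted-column-upper (+ p) (+ d) (+ λ′) (+ J) i
        (subst (ℤ._< _) (cong (ℤ._* i) (pos-* p p)) row-upper))

proposition3p4 : ∀ {c ℓ : Level} (k : CommutativeRing c ℓ) (p d J : ℕ) →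
    IsField k → Prime p → ¬ (2 ∣ p) → HasCharacteristic k p →
    0 < d → ¬ (p ∣ d) → 1 < J → J < p →
    let open Poly k d in
    -- (1)
    (∀ (i : ℤ) (λ′ : ℕ) (i′ : ℤ) → InR p d J i λ′ → InC p d J i′ →
       + (λ′ * d) ℤ.< + p ℤ.* i ℤ.- i′ →
       ∃ λ (i″ : ℤ) → InC p d J i″ × (i′ ℤ.< i″)
         × (M p i λ′ i″ ≈S b λ′ (λ′ * d))
         × (b λ′ (λ′ * d) ≈S (a (fromℕ d) ^S λ′)))
    ×
    -- (2)
    (∀ (i : ℤ) (λ′ : ℕ) (i′ : ℤ) → InR p d J i λ′ → InC p d J i′ →
       (+ λ′ ℤ.- ℤ.1ℤ) ℤ.* + d ℤ.< + p ℤ.* i ℤ.- i′)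
proposition3p4 k p d J _ p-prime _ _ _ p∤d _ J<p =
  (λ i λ′ i′ r c λd<pi-i′ →
     let (i″∈C , i′<i″) = leading-column p-prime p∤d J<p r c λd<pi-i′
     in  + p ℤ.* i ℤ.- + (λ′ * d) , i″∈C , i′<i″ , M-shifted-column p i λ′ (λ′ * d) , coeff-f^P-top λ′)
  , (λ i λ′ i′ → InR∧InC⇒degree-gap)
  where open Coefficients k d
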